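{- Let $\mathbf{D}$ be a locally small dagger kernel category. For each object $X$, the set $\mathrm{End}(X)=\mathbf{D}(X,X)$ with composition, unit $\mathrm{id}_X$, involution $s\mapsto s^\dagger$ and the operation $[s]=\ker(s)\circ\ker(s)^\dagger$ is a Foulis semigroup. Moreover, the mapping $X\mapsto\mathrm{End}(X)$, sending $f\colon X\to Y$ to the function $\mathrm{End}(X)\to\mathrm{End}(Y)$, $s\mapsto f\circ s\circ f^\dagger$, is a functor $\mathbf{D}\to\mathbf{Sets}$.
   Context: A dagger kernel category is a category $\mathbf{D}$ with an identity-on-objects functor $\dagger\colon\mathbf{D}^{\mathrm{op}}\to\mathbf{D}$ with $f^{\dagger\dagger}=f$, a zero object, and for every morphism $f$ a kernel $\ker(f)$ that is a dagger mono ($\ker(f)^\dagger\circ\ker(f)=\mathrm{id}$). A Foulis semigroup is a monoid $(S,\cdot,1)$ with maps $(-)^\dagger\colon S\to S$ and $[-]\colon S\to S$ such that: (1) $1^\dagger=1$, $(s\cdot t)^\dagger=t^\dagger\cdot s^\dagger$, $s^{\dagger\dagger}=s$; (2) $[s]\cdot[s]=[s]=[s]^\dagger$; (3) $0:=[1]$ satisfies $0\cdot s=0=s\cdot 0$; (4) $s\cdot x=0$ iff there is $y$ with $x=[s]\cdot y$. -}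

module Defs where

open import Level using (Level; _⊔_; suc)
open import Data.Product using (Σ; ∃; _×_; _,_)
open import Relation.Binary.PropositionalEquality using (_≡_)
open import Function.Bundles using (_⇔_)

record Category (o ℓ : Level) : Set (suc (o ⊔ ℓ)) where
  infixr 9 _∘_
  field
    Obj  : Set o
    Hom  : Obj → Obj → Set ℓ
    id   : ∀ {X} → Hom X X
    _∘_  : ∀ {X Y Z} → Hom Y Z → Hom X Y → Hom X Z
    assoc    : ∀ {W X Y Z} (h : Hom Y Z) (g : Hom X Y) (f : Hom W X) →
               (h ∘ g) ∘ f ≡ h ∘ (g ∘ f)
    identityˡ : ∀ {X Y} (f : Hom X Y) → id ∘ f ≡ f
    identityʳ : ∀ {X Y} (f : Hom X Y) → f ∘ id ≡ f

record DaggerKernelCategory (o ℓ : Level) : Set (suc (o ⊔ ℓ)) where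
  field
    cat : Category o ℓ
  open Category cat public
  infix 10 _†
  field
    _†      : ∀ {X Y} → Hom X Y → Hom Y X
    †-id    : ∀ {X} → (id {X}) † ≡ id
    †-∘     : ∀ {X Y Z} (g : Hom Y Z) (f : Hom X Y) → (g ∘ f) † ≡ f † ∘ g †
    †-invol : ∀ {X Y} (f : Hom X Y) → (f †) † ≡ f
    𝟘      : Obj
    ¡      : ∀ {X} → Hom 𝟘 X
    ¡-unique : ∀ {X} (g : Hom 𝟘 X) → g ≡ ¡
    !      : ∀ {X} → Hom X 𝟘
    !-unique : ∀ {X} (g : Hom X 𝟘) → g ≡ !

  zero : ∀ {X Y} → Hom X Y
  zero = ¡ ∘ !

  field
    KerObj : ∀ {X Y} → Hom X Y → Obj
    ker    : ∀ {X Y} (f : Hom X Y) → Hom (KerObj f) X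
    ker-zero : ∀ {X Y} (f : Hom X Y) → f ∘ ker f ≡ zero
    ker-factor : ∀ {W X Y} (f : Hom X Y) (g : Hom W X) → f ∘ g ≡ zero →
                 Hom W (KerObj f)
    ker-factor-commutes : ∀ {W X Y} (f : Hom X Y) (g : Hom W X) (p : f ∘ g ≡ zero) →
                 ker f ∘ ker-factor f g p ≡ g
    ker-factor-unique : ∀ {W X Y} (f : Hom X Y) (g : Hom W X) (p : f ∘ g ≡ zero)
                 (h : Hom W (KerObj f)) → ker f ∘ h ≡ g → h ≡ ker-factor f g p
    ker-dagger-mono : ∀ {X Y} (f : Hom X Y) → (ker f) † ∘ ker f ≡ id

record IsFoulisSemigroup {a : Level} (S : Set a)
    (_·_ : S → S → S) (𝟙 : S) (_ᵈ : S → S) ([_] : S → S) : Set a where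
  𝟎 : S
  𝟎 = [ 𝟙 ]
  field
    ·-assoc : ∀ s t u → (s · t) · u ≡ s · (t · u)
    ·-identityˡ : ∀ s → 𝟙 · s ≡ s
    ·-identityʳ : ∀ s → s · 𝟙 ≡ s
    ᵈ-unit  : 𝟙 ᵈ ≡ 𝟙
    ᵈ-anti  : ∀ s t → (s · t) ᵈ ≡ (t ᵈ) · (s ᵈ)
    ᵈ-invol : ∀ s → (s ᵈ) ᵈ ≡ s
    []-idem : ∀ s → [ s ] · [ s ] ≡ [ s ]
    []-self : ∀ s → [ s ] ≡ [ s ] ᵈ
    𝟎-absorbˡ : ∀ s → 𝟎 · s ≡ 𝟎
    𝟎-absorbʳ : ∀ s → s · 𝟎 ≡ 𝟎
    foulis : ∀ s x → (s · x ≡ 𝟎) ⇔ (∃ λ y → x ≡ [ s ] · y)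

module _ {o ℓ : Level} (D : DaggerKernelCategory o ℓ) where
  open DaggerKernelCategory D

  End : Obj → Set ℓ
  End X = Hom X X

  bracket : ∀ {X} → End X → End X
  bracket s = ker s ∘ (ker s) †

  End₁ : ∀ {X Y} → Hom X Y → End X → End Y
  End₁ f s = f ∘ (s ∘ f †)

module Submission where

-- The monoid and involution axioms are the category and dagger laws.  The
-- remaining axioms rest on three facts, proved for arbitrary morphisms:
--   * zero morphisms absorb composition on either side, and ker(id) = 0,
--     so the Foulis zero [id] is the zero endomorphism;
--   * ker(f) ∘ ker(f)† is a self-adjoint idempotent, because ker(f) is a
--     dagger mono (it fixes everything factoring through ker(f));
--   * s ∘ x = 0 iff x = [s] ∘ y for some y: the forward direction takes
--     y = x, since x factors through ker(s) and [s] fixes such maps; the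
--     backward direction is s ∘ ker(s) = 0.
-- Functoriality is a direct calculation with the dagger laws.

open import Level using (Level)
open import Data.Product using (_×_; _,_; ∃)
open import Relation.Binary.PropositionalEquality
  using (_≡_; refl; sym; trans; cong; module ≡-Reasoning)
open import Function.Bundles using (mk⇔)
open import Defs

module DaggerKernelFacts {o ℓ : Level} (D : DaggerKernelCategory o ℓ) where
  open DaggerKernelCategory D
  open ≡-Reasoning

  zero-absorbˡ : ∀ {X Y Z} (h : Hom X Y) → zero {Y} {Z} ∘ h ≡ zero
  zero-absorbˡ h = trans (assoc ¡ ! h) (cong (¡ ∘_) (!-unique (! ∘ h)))

  zero-absorbʳ : ∀ {X Y Z} (h : Hom Y Z) → h ∘ zero {X} {Y} ≡ zero
  zero-absorbʳ h = trans (sym (assoc h ¡ !)) (cong (_∘ !) (¡-unique (h ∘ ¡)))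

  ker-id : ∀ {X} → ker (id {X}) ≡ zero
  ker-id = trans (sym (identityˡ _)) (ker-zero id)

  bracket-id : ∀ {X} → bracket D (id {X}) ≡ zero
  bracket-id = begin
    ker id ∘ ker id † ≡⟨ cong (_∘ ker id †) ker-id ⟩
    zero ∘ ker id †   ≡⟨ zero-absorbˡ _ ⟩
    zero              ∎

  self-adjoint : ∀ {X Y} (f : Hom X Y) → f ∘ f † ≡ (f ∘ f †) †
  self-adjoint f = sym (trans (†-∘ f (f †)) (cong (_∘ f †) (†-invol f)))

  -- The projection ker(f) ∘ ker(f)† fixes every map factoring through
  -- ker(f); this uses that kernels are dagger monos.
  ker-projection-fixes : ∀ {W X Y} (f : Hom X Y) (k : Hom W (KerObj f)) →
    (ker f ∘ ker f †) ∘ (ker f ∘ k) ≡ ker f ∘ k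
  ker-projection-fixes f k = begin
    (ker f ∘ ker f †) ∘ (ker f ∘ k) ≡⟨ assoc _ _ _ ⟩
    ker f ∘ (ker f † ∘ (ker f ∘ k)) ≡⟨ cong (ker f ∘_) (sym (assoc _ _ _)) ⟩
    ker f ∘ ((ker f † ∘ ker f) ∘ k) ≡⟨ cong (λ z → ker f ∘ (z ∘ k)) (ker-dagger-mono f) ⟩
    ker f ∘ (id ∘ k)                ≡⟨ cong (ker f ∘_) (identityˡ k) ⟩
    ker f ∘ k                       ∎

  ker-projection-fixes-annihilated : ∀ {W X Y} (f : Hom X Y) (x : Hom W X) →
    f ∘ x ≡ zero → (ker f ∘ ker f †) ∘ x ≡ x
  ker-projection-fixes-annihilated f x fx≡0 = begin
    (ker f ∘ ker f †) ∘ x ≡⟨ cong ((ker f ∘ ker f †) ∘_) (sym factors) ⟩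
    (ker f ∘ ker f †) ∘ (ker f ∘ k) ≡⟨ ker-projection-fixes f k ⟩
    ker f ∘ k ≡⟨ factors ⟩
    x ∎
    where
    k = ker-factor f x fx≡0
    factors : ker f ∘ k ≡ x
    factors = ker-factor-commutes f x fx≡0

  annihilates-ker-projection : ∀ {W X Y} (f : Hom X Y) (y : Hom W X) →
    f ∘ ((ker f ∘ ker f †) ∘ y) ≡ zero
  annihilates-ker-projection f y = begin
    f ∘ ((ker f ∘ ker f †) ∘ y) ≡⟨ cong (f ∘_) (assoc _ _ _) ⟩
    f ∘ (ker f ∘ (ker f † ∘ y)) ≡⟨ sym (assoc _ _ _) ⟩
    (f ∘ ker f) ∘ (ker f † ∘ y) ≡⟨ cong (_∘ (ker f † ∘ y)) (ker-zero f) ⟩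
    zero ∘ (ker f † ∘ y)        ≡⟨ zero-absorbˡ _ ⟩
    zero                        ∎

  endFoulis : ∀ X → IsFoulisSemigroup (End D X) _∘_ id _† (bracket D)
  endFoulis X = record
    { ·-assoc     = assoc
    ; ·-identityˡ = identityˡ
    ; ·-identityʳ = identityʳ
    ; ᵈ-unit      = †-id
    ; ᵈ-anti      = †-∘
    ; ᵈ-invol     = †-invol
    ; []-idem     = λ s → ker-projection-fixes s (ker s †)
    ; []-self     = λ s → self-adjoint (ker s)
    ; 𝟎-absorbˡ   = λ s → trans (cong (_∘ s) bracket-id)
                              (trans (zero-absorbˡ s) (sym bracket-id))
    ; 𝟎-absorbʳ   = λ s → trans (cong (s ∘_) bracket-id)
                              (trans (zero-absorbʳ s) (sym bracket-id))
    ; foulis      = λ s x → mk⇔ (to s x) (from s x)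
    }
    where
    to : ∀ (s x : End D X) → s ∘ x ≡ bracket D id → ∃ λ y → x ≡ bracket D s ∘ y
    to s x sx≡0 =
      x , sym (ker-projection-fixes-annihilated s x (trans sx≡0 bracket-id))

    from : ∀ (s x : End D X) → (∃ λ y → x ≡ bracket D s ∘ y) → s ∘ x ≡ bracket D id
    from s x (y , refl) = trans (annihilates-ker-projection s y) (sym bracket-id)

  conj-id : ∀ {X} (s : End D X) → End₁ D (id {X}) s ≡ s
  conj-id s = begin
    id ∘ (s ∘ id †) ≡⟨ identityˡ _ ⟩
    s ∘ id †        ≡⟨ cong (s ∘_) †-id ⟩
    s ∘ id          ≡⟨ identityʳ s ⟩
    s               ∎

  conj-∘ : ∀ {X Y Z} (f : Hom X Y) (g : Hom Y Z) (s : End D X) →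
    End₁ D (g ∘ f) s ≡ End₁ D g (End₁ D f s)
  conj-∘ f g s = begin
    (g ∘ f) ∘ (s ∘ (g ∘ f) †)     ≡⟨ cong (λ z → (g ∘ f) ∘ (s ∘ z)) (†-∘ g f) ⟩
    (g ∘ f) ∘ (s ∘ (f † ∘ g †))   ≡⟨ assoc _ _ _ ⟩
    g ∘ (f ∘ (s ∘ (f † ∘ g †)))   ≡⟨ cong (λ z → g ∘ (f ∘ z)) (sym (assoc _ _ _)) ⟩
    g ∘ (f ∘ ((s ∘ f †) ∘ g †))   ≡⟨ cong (g ∘_) (sym (assoc _ _ _)) ⟩
    g ∘ ((f ∘ (s ∘ f †)) ∘ g †)   ∎

proposition4p2 : ∀ {o ℓ : Level} (D : DaggerKernelCategory o ℓ) →
    let open DaggerKernelCategory D in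
    (∀ (X : Obj) → IsFoulisSemigroup (End D X) _∘_ id _† (bracket D))
    × (∀ {X : Obj} (s : End D X) → End₁ D (id {X}) s ≡ s)
    × (∀ {X Y Z : Obj} (f : Hom X Y) (g : Hom Y Z) (s : End D X) →
         End₁ D (g ∘ f) s ≡ End₁ D g (End₁ D f s))
proposition4p2 D = endFoulis , conj-id , conj-∘
  where open DaggerKernelFacts D
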